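{- Fix integers $n\ge0$ and $i\ge0$. Consider the left half of row $i$ of the difference table, i.e. the entries $F'(i-y,y)$ for integers $y$ with $y<i-y$, read from left to right (in order of increasing $y$, starting from $y\to-\infty$). These entries first weakly increase and then weakly decrease: there exists an integer $m$ such that $F'(i-y,y)$ is weakly increasing in $y$ for $y\le m$ and weakly decreasing in $y$ for $m\le y<i/2$.
   Context: For a fixed integer $n\ge0$, define $F:\mathbb{Z}^2\to\mathbb{Z}_{\ge0}$ by $F(0,0)=2^n$, $F(x,y)=\lfloor F(x-1,y)/2\rfloor+\lfloor F(x,y-1)/2\rfloor$ for every $(x,y)\in\mathbb{Z}_{\ge0}^2\setminus\{(0,0)\}$, and $F(x,y)=0$ for $(x,y)$ outside the first quadrant (the intermediate firing configuration of chip-firing on the quadrant lattice graph started with $2^n$ chips at the origin). The difference table is $F'(x,y)=F(x-1,y)-F(x,y-1)$ for $(x,y)\in\mathbb{Z}^2$; row $i$ of the difference table consists of the entries $F'(x,y)$ with $x+y=i$, ordered left to right by increasing $y$. -}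

module Defs where

open import Data.Nat as N using (ℕ; zero; suc; _^_; _/_)
open import Data.Integer using (ℤ; +_; -[1+_]; _-_)

Fℕ : ℕ → ℕ → ℕ → ℕ
Fℕ n zero    zero    = 2 ^ n
Fℕ n (suc x) zero    = Fℕ n x zero / 2
Fℕ n zero    (suc y) = Fℕ n zero y / 2
Fℕ n (suc x) (suc y) = Fℕ n x (suc y) / 2 N.+ Fℕ n (suc x) y / 2

F : ℕ → ℤ → ℤ → ℕ
F n (+ x)    (+ y)    = Fℕ n x y
F n (+ x)    -[1+ _ ] = 0
F n -[1+ _ ] _        = 0

F′ : ℕ → ℤ → ℤ → ℤ
F′ n x y = + F n (x - + 1) y - + F n x (y - + 1)

rowEntry : ℕ → ℕ → ℤ → ℤ
rowEntry n i y = F′ n (+ i - y) y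

{-# OPTIONS --safe #-}
-- Pad each row of F with zeros on the left.  Then row s + 1 arises from row s by the firing
-- map a ↦ (⌊a_y / 2⌋ + ⌊a_{y-1} / 2⌋)_y, and row s + 1 of the difference table is the sequence
-- of first differences of row s.  So it suffices that on its left half every row of F
-- increases and is first convex, then concave.  Floor-halving preserves convexity (and
-- concavity) of four consecutive entries -- the delicate case, equality, forces an arithmetic
-- progression -- so after firing only the second difference at the old peak is undecided,
-- and the peak moves right by at most one.  From an odd row to the next even row the left
-- half gains an entry; the two middle entries of an odd row are equal by the symmetry
-- F(x, y) = F(y, x), which supplies the new concave step.
module Submission where

open import Defs
open import Data.Product using (∃; ∃₂; _×_; _,_)
open import Relation.Binary.PropositionalEquality

module Halving where

  open import Data.Nat
  open import Data.Nat.Properties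
  open import Data.Nat.DivMod
  open import Data.Nat.Divisibility using (divides)
  open import Data.Nat.Tactic.RingSolver using (solve-∀)
  open import Algebra.Properties.CommutativeSemigroup +-commutativeSemigroup using (xy∙z≈xz∙y)
  open import Data.Sum using (inj₁; inj₂)

  halve-+ : ∀ u x → (u * 2 + x) / 2 ≡ u + x / 2
  halve-+ u x = trans (+-distrib-/-∣ˡ x (divides u refl)) (cong (_+ x / 2) (m*n/n≡m u 2))

  m≤1+[m/2]*2 : ∀ m → m ≤ suc (m / 2 * 2)
  m≤1+[m/2]*2 m = s≤s⁻¹ (subst (_< 2 + m / 2 * 2) (sym (m≡m%n+[m/n]*n m 2))
                                (+-monoˡ-< (m / 2 * 2) (m%n<n m 2)))

  halves-<⇒≤ : ∀ a b c d → a + b < c + d → a / 2 + b / 2 ≤ c / 2 + d / 2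
  halves-<⇒≤ a b c d a+b<c+d = s≤s⁻¹ (*-cancelʳ-< 2 _ _ (begin-strict
    (a / 2 + b / 2) * 2                ≡⟨ *-distribʳ-+ 2 (a / 2) (b / 2) ⟩
    a / 2 * 2 + b / 2 * 2              ≤⟨ +-mono-≤ (m/n*n≤m a 2) (m/n*n≤m b 2) ⟩
    a + b                              <⟨ a+b<c+d ⟩
    c + d                              ≤⟨ +-mono-≤ (m≤1+[m/2]*2 c) (m≤1+[m/2]*2 d) ⟩
    suc (c / 2 * 2) + suc (d / 2 * 2)  ≡⟨ regroup (c / 2) (d / 2) ⟩
    suc (c / 2 + d / 2) * 2            ∎))
    where
    open ≤-Reasoning
    regroup : ∀ x y → suc (x * 2) + suc (y * 2) ≡ suc (x + y) * 2
    regroup = solve-∀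

  private
    twice-a+u : ∀ u a → (a + u) + (a + u) ≡ (u * 2 + a) + a
    twice-a+u = solve-∀
    twice-u*2+a : ∀ u a → (u * 2 + a) + (u * 2 + a) ≡ (u * 2 + (a + u)) + (a + u)
    twice-u*2+a = solve-∀

  -- b = a + u forces c = a + 2u and d = a + 3u, and halving c and d just splits off u.
  halves-progression-≤ : ∀ a b c d → a ≤ b → c + a ≡ b + b → d + b ≡ c + c →
                         c / 2 + b / 2 ≡ d / 2 + a / 2
  halves-progression-≤ a _ c d a≤b c+a≡b+b d+b≡c+c
    with u , refl ← m≤n⇒∃[o]m+o≡n a≤b
    with refl ← +-cancelʳ-≡ a c (u * 2 + a) (trans c+a≡b+b (twice-a+u u a))
    with refl ← +-cancelʳ-≡ (a + u) d (u * 2 + (a + u)) (trans d+b≡c+c (twice-u*2+a u a)) = begin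
      (u * 2 + a) / 2 + (a + u) / 2        ≡⟨ cong (_+ (a + u) / 2) (halve-+ u a) ⟩
      u + a / 2 + (a + u) / 2              ≡⟨ xy∙z≈xz∙y u (a / 2) ((a + u) / 2) ⟩
      u + (a + u) / 2 + a / 2              ≡⟨ cong (_+ a / 2) (halve-+ u (a + u)) ⟨
      (u * 2 + (a + u)) / 2 + a / 2        ∎
    where open ≡-Reasoning

  progression-antitone : ∀ {a b c} → c + a ≡ b + b → b ≤ a → c ≤ b
  progression-antitone {a} {b} {c} c+a≡b+b b≤a =
    +-cancelʳ-≤ a c b (subst (_≤ b + a) (sym c+a≡b+b) (+-monoʳ-≤ b b≤a))

  halves-progression : ∀ a b c d → c + a ≡ b + b → d + b ≡ c + c →
                       c / 2 + b / 2 ≡ d / 2 + a / 2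
  halves-progression a b c d c+a≡b+b d+b≡c+c with ≤-total a b
  ... | inj₁ a≤b = halves-progression-≤ a b c d a≤b c+a≡b+b d+b≡c+c
  ... | inj₂ b≤a = begin
    c / 2 + b / 2  ≡⟨ +-comm (c / 2) (b / 2) ⟩
    b / 2 + c / 2  ≡⟨ halves-progression-≤ d c b a d≤c (trans (+-comm b d) d+b≡c+c)
                                                      (trans (+-comm a c) c+a≡b+b) ⟩
    a / 2 + d / 2  ≡⟨ +-comm (a / 2) (d / 2) ⟩
    d / 2 + a / 2  ∎
    where
    open ≡-Reasoning
    d≤c : d ≤ c
    d≤c = progression-antitone d+b≡c+c (progression-antitone c+a≡b+b b≤a)

  +-mono-≤-tight : ∀ {x y z w} → x ≤ y → z ≤ w → x + z ≡ y + w → x ≡ y × z ≡ w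
  +-mono-≤-tight {x} {y} {z} {w} x≤y z≤w x+z≡y+w =
    x≡y , +-cancelˡ-≡ y z w (subst (λ t → t + z ≡ y + w) x≡y x+z≡y+w)
    where
    x≡y : x ≡ y
    x≡y = ≤-antisym x≤y (+-cancelʳ-≤ z y x (subst (y + z ≤_) (sym x+z≡y+w) (+-monoʳ-≤ y z≤w)))

  halves-mono-≤ : ∀ a b c d → a + b ≤ c + d →
                  (a + b ≡ c + d → a / 2 + b / 2 ≡ c / 2 + d / 2) →
                  a / 2 + b / 2 ≤ c / 2 + d / 2
  halves-mono-≤ a b c d a+b≤c+d on-equality with m≤n⇒m<n∨m≡n a+b≤c+d
  ... | inj₁ a+b<c+d = halves-<⇒≤ a b c d a+b<c+d
  ... | inj₂ a+b≡c+d = ≤-reflexive (on-equality a+b≡c+d)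

  -- The sum of the two second differences of a, b, c, d is (d + a) - (c + b).
  private
    double-middle : ∀ b c → (b + b) + (c + c) ≡ (c + b) + (c + b)
    double-middle = solve-∀
    cross : ∀ a b c d → (c + a) + (d + b) ≡ (c + b) + (d + a)
    cross = solve-∀

  halves-convex : ∀ a b c d → b + b ≤ c + a → c + c ≤ d + b → c / 2 + b / 2 ≤ d / 2 + a / 2
  halves-convex a b c d h₁ h₂ = halves-mono-≤ c b d a outer on-equality
    where
    outer : c + b ≤ d + a
    outer = +-cancelˡ-≤ (c + b) (c + b) (d + a)
              (subst₂ _≤_ (double-middle b c) (cross a b c d) (+-mono-≤ h₁ h₂))
    on-equality : c + b ≡ d + a → c / 2 + b / 2 ≡ d / 2 + a / 2
    on-equality e
      with e₁ , e₂ ← +-mono-≤-tight h₁ h₂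
                       (trans (double-middle b c) (trans (cong ((c + b) +_) e) (sym (cross a b c d))))
      = halves-progression a b c d (sym e₁) (sym e₂)

  halves-concave : ∀ a b c d → c + a ≤ b + b → d + b ≤ c + c → d / 2 + a / 2 ≤ c / 2 + b / 2
  halves-concave a b c d h₁ h₂ = halves-mono-≤ d a c b outer on-equality
    where
    outer : d + a ≤ c + b
    outer = +-cancelˡ-≤ (c + b) (d + a) (c + b)
              (subst₂ _≤_ (cross a b c d) (double-middle b c) (+-mono-≤ h₁ h₂))
    on-equality : d + a ≡ c + b → d / 2 + a / 2 ≡ c / 2 + b / 2
    on-equality e
      with e₁ , e₂ ← +-mono-≤-tight h₁ h₂
                       (trans (cross a b c d) (trans (cong ((c + b) +_) e) (sym (double-middle b c))))
      = sym (halves-progression a b c d e₁ e₂)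

module Firing where

  open import Data.Nat
  open import Data.Nat.Properties
  open import Data.Nat.DivMod using (/-monoˡ-≤)
  open import Data.Nat.Tactic.RingSolver using (solve-∀)
  open import Data.Sum using (inj₁; inj₂)
  open Halving using (halves-convex; halves-concave)

  fire : (ℕ → ℕ) → ℕ → ℕ
  fire f zero    = 0
  fire f (suc j) = f (suc j) / 2 + f j / 2

  ConvexAt : (ℕ → ℕ) → ℕ → Set
  ConvexAt f j = f (suc j) + f (suc j) ≤ f (suc (suc j)) + f j

  ConcaveAt : (ℕ → ℕ) → ℕ → Set
  ConcaveAt f j = f (suc (suc j)) + f j ≤ f (suc j) + f (suc j)

  IncreasingUpTo : (ℕ → ℕ) → ℕ → Set
  IncreasingUpTo f K = ∀ j → j ≤ K → f j ≤ f (suc j)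

  ConvexThenConcave : (ℕ → ℕ) → ℕ → ℕ → Set
  ConvexThenConcave f K p = (∀ j → j ≤ p → j ≤ K → ConvexAt f j)
                          × (∀ j → p < j → j ≤ K → ConcaveAt f j)

  LeftHalfShape : (ℕ → ℕ) → ℕ → Set
  LeftHalfShape f M = IncreasingUpTo f (suc M) × ∃ (ConvexThenConcave f M)

  private
    regroup : ∀ x y z w → (z + w) + (x + y) ≡ (z + x) + (y + w)
    regroup = solve-∀

    twice-≤ : ∀ x y z w → x + y ≤ z + w → (x + y) + (x + y) ≤ (z + x) + (y + w)
    twice-≤ x y z w h = subst ((x + y) + (x + y) ≤_) (regroup x y z w) (+-monoˡ-≤ (x + y) h)

    twice-≥ : ∀ x y z w → z + w ≤ x + y → (z + x) + (y + w) ≤ (x + y) + (x + y)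
    twice-≥ x y z w h = subst (_≤ (x + y) + (x + y)) (regroup x y z w) (+-monoˡ-≤ (x + y) h)

  fire-increasing : ∀ {f K} → IncreasingUpTo f K → IncreasingUpTo (fire f) K
  fire-increasing inc zero    _      = z≤n
  fire-increasing inc (suc j) 1+j≤K =
    +-mono-≤ (/-monoˡ-≤ 2 (inc (suc j) 1+j≤K)) (/-monoˡ-≤ 2 (inc j (<⇒≤ 1+j≤K)))

  fire-convexAt : ∀ {f j} → ConvexAt f j → ConvexAt f (suc j) → ConvexAt (fire f) (suc j)
  fire-convexAt {f} {j} h₁ h₂ =
    twice-≤ (c / 2) (b / 2) (d / 2) (a / 2) (halves-convex a b c d h₁ h₂)
    where
    a b c d : ℕ
    a = f j
    b = f (1 + j)
    c = f (2 + j)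
    d = f (3 + j)

  fire-concaveAt : ∀ {f j} → ConcaveAt f j → ConcaveAt f (suc j) → ConcaveAt (fire f) (suc j)
  fire-concaveAt {f} {j} h₁ h₂ =
    twice-≥ (c / 2) (b / 2) (d / 2) (a / 2) (halves-concave a b c d h₁ h₂)
    where
    a b c d : ℕ
    a = f j
    b = f (1 + j)
    c = f (2 + j)
    d = f (3 + j)

  -- Every index is convex or concave, so the undecided index suc p can join either side.
  convexThenConcave-fill : ∀ {g K p} → (∀ j → j ≤ p → j ≤ K → ConvexAt g j) →
                           (∀ j → suc p < j → j ≤ K → ConcaveAt g j) → ∃ (ConvexThenConcave g K)
  convexThenConcave-fill {g} {K} {p} cvx ccv
    with ≤-total (g (2 + p) + g (2 + p)) (g (3 + p) + g (1 + p))
  ... | inj₁ convex  = suc p , cvx′ , ccv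
    where
    cvx′ : ∀ j → j ≤ suc p → j ≤ K → ConvexAt g j
    cvx′ j j≤1+p j≤K with m≤n⇒m<n∨m≡n j≤1+p
    ... | inj₁ j<1+p = cvx j (s≤s⁻¹ j<1+p) j≤K
    ... | inj₂ refl  = convex
  ... | inj₂ concave = p , cvx , ccv′
    where
    ccv′ : ∀ j → p < j → j ≤ K → ConcaveAt g j
    ccv′ j p<j j≤K with m≤n⇒m<n∨m≡n p<j
    ... | inj₁ 1+p<j = ccv j 1+p<j j≤K
    ... | inj₂ refl  = concave

  fire-convexThenConcave : ∀ {f K p} → f 0 ≡ 0 → f 1 ≡ 0 → ConvexThenConcave f K p →
                           ∃ (ConvexThenConcave (fire f) K)
  fire-convexThenConcave {f} {K} {p} f0≡0 f1≡0 (cvx , ccv) =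
    convexThenConcave-fill {fire f} cvx′ ccv′
    where
    cvx′ : ∀ j → j ≤ p → j ≤ K → ConvexAt (fire f) j
    cvx′ zero    _     _     rewrite f0≡0 | f1≡0 = z≤n
    cvx′ (suc j) j<p j<K = fire-convexAt {f} (cvx j (<⇒≤ j<p) (<⇒≤ j<K)) (cvx (suc j) j<p j<K)
    ccv′ : ∀ j → suc p < j → j ≤ K → ConcaveAt (fire f) j
    ccv′ (suc j) (s≤s p<j) j<K =
      fire-concaveAt {f} (ccv j p<j (<⇒≤ j<K)) (ccv (suc j) (m<n⇒m<1+n p<j) j<K)

  convexThenConcave-snoc : ∀ {f K p} → ConvexThenConcave f K p → ConcaveAt f (suc K) →
                           ConvexThenConcave f (suc K) (p ⊓ K)
  convexThenConcave-snoc {f} {K} {p} (cvx , ccv) concave = cvx′ , ccv′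
    where
    cvx′ : ∀ j → j ≤ p ⊓ K → j ≤ suc K → ConvexAt f j
    cvx′ j j≤p⊓K _ = cvx j (≤-trans j≤p⊓K (m⊓n≤m p K)) (≤-trans j≤p⊓K (m⊓n≤n p K))
    ccv′ : ∀ j → p ⊓ K < j → j ≤ suc K → ConcaveAt f j
    ccv′ j p⊓K<j j≤1+K with m≤n⇒m<n∨m≡n j≤1+K
    ... | inj₂ refl  = concave
    ... | inj₁ j<1+K = ccv j p<j j≤K
      where
      j≤K : j ≤ K
      j≤K = s≤s⁻¹ j<1+K
      p<j : p < j
      p<j = ≰⇒> λ j≤p → <⇒≱ p⊓K<j (⊓-glb j≤p j≤K)

  fire-leftHalfShape : ∀ {f M} → f 0 ≡ 0 → f 1 ≡ 0 → LeftHalfShape f M → LeftHalfShape (fire f) M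
  fire-leftHalfShape f0≡0 f1≡0 (inc , _ , shape) =
    fire-increasing inc , fire-convexThenConcave f0≡0 f1≡0 shape

  leftHalfShape-extend : ∀ {f M} → f (3 + M) ≡ f (2 + M) → LeftHalfShape f M →
                         LeftHalfShape f (suc M)
  leftHalfShape-extend {f} {M} middle (inc , p , shape) =
    inc′ , p ⊓ M , convexThenConcave-snoc {f} shape concave
    where
    inc′ : IncreasingUpTo f (2 + M)
    inc′ j j≤2+M with m≤n⇒m<n∨m≡n j≤2+M
    ... | inj₁ j<2+M = inc j (s≤s⁻¹ j<2+M)
    ... | inj₂ refl  = ≤-reflexive (sym middle)
    concave : ConcaveAt f (suc M)
    concave = subst (λ x → x + f (suc M) ≤ f (2 + M) + f (2 + M)) (sym middle)
                    (+-monoʳ-≤ (f (2 + M)) (inc (suc M) ≤-refl))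

module Rows where

  open import Data.Nat
  open import Data.Nat.Properties
  open Firing

  initialRow : ℕ → ℕ → ℕ
  initialRow n 2 = 2 ^ n
  initialRow n _ = 0

  -- row n s (2 + y) = F(s - y, y): row s of F preceded by two zeros (y = -2, -1), so that
  -- the first and second differences at the left border are indexed too.
  row : ℕ → ℕ → ℕ → ℕ
  row n zero    = initialRow n
  row n (suc s) = fire (row n s)

  row-0 : ∀ n s → row n s 0 ≡ 0
  row-0 n zero    = refl
  row-0 n (suc s) = refl

  row-1 : ∀ n s → row n s 1 ≡ 0
  row-1 n zero    = refl
  row-1 n (suc s) rewrite row-1 n s | row-0 n s = refl

  row-vanishes : ∀ n s {j} → 3 + s ≤ j → row n s j ≡ 0
  row-vanishes n zero    (s≤s (s≤s (s≤s _))) = refl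
  row-vanishes n (suc s) (s≤s 3+s≤j)
    rewrite row-vanishes n s (m≤n⇒m≤1+n 3+s≤j) | row-vanishes n s 3+s≤j = refl

  Fℕ-row : ∀ n x y → Fℕ n x y ≡ row n (x + y) (2 + y)
  Fℕ-row n zero    zero    = refl
  Fℕ-row n (suc x) zero    rewrite Fℕ-row n x zero | row-1 n (x + 0) = sym (+-identityʳ _)
  Fℕ-row n zero    (suc y) rewrite Fℕ-row n zero y | row-vanishes n y (≤-refl {3 + y}) = refl
  Fℕ-row n (suc x) (suc y) rewrite Fℕ-row n x (suc y) | Fℕ-row n (suc x) y | +-suc x y = refl

  Fℕ-sym : ∀ n x y → Fℕ n x y ≡ Fℕ n y x
  Fℕ-sym n zero    zero    = refl
  Fℕ-sym n (suc x) zero    = cong (_/ 2) (Fℕ-sym n x zero)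
  Fℕ-sym n zero    (suc y) = cong (_/ 2) (Fℕ-sym n zero y)
  Fℕ-sym n (suc x) (suc y) rewrite Fℕ-sym n x (suc y) | Fℕ-sym n (suc x) y =
    +-comm (Fℕ n (suc y) x / 2) (Fℕ n y (suc x) / 2)

  row-middle : ∀ n M → row n (suc (M + M)) (3 + M) ≡ row n (suc (M + M)) (2 + M)
  row-middle n M = begin
    row n (suc (M + M)) (3 + M)  ≡⟨ cong (λ s → row n s (3 + M)) (+-suc M M) ⟨
    row n (M + suc M) (3 + M)    ≡⟨ Fℕ-row n M (suc M) ⟨
    Fℕ n M (suc M)               ≡⟨ Fℕ-sym n M (suc M) ⟩
    Fℕ n (suc M) M               ≡⟨ Fℕ-row n (suc M) M ⟩
    row n (suc (M + M)) (2 + M)  ∎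
    where open ≡-Reasoning

  initialRow-shape : ∀ n → LeftHalfShape (row n 0) 0
  initialRow-shape n = increasing , 0 , convex , concave
    where
    increasing : IncreasingUpTo (initialRow n) 1
    increasing zero       _ = z≤n
    increasing (suc zero) _ = z≤n
    increasing (suc (suc _)) (s≤s ())
    convex : ∀ j → j ≤ 0 → j ≤ 0 → ConvexAt (initialRow n) j
    convex zero _ _ = z≤n
    concave : ∀ j → 0 < j → j ≤ 0 → ConcaveAt (initialRow n) j
    concave (suc _) _ ()

  row-step-shape : ∀ n s {M} → LeftHalfShape (row n s) M → LeftHalfShape (row n (suc s)) M
  row-step-shape n s = fire-leftHalfShape (row-0 n s) (row-1 n s)

  row-shape-even : ∀ n M → LeftHalfShape (row n (M + M)) M
  row-shape-odd  : ∀ n M → LeftHalfShape (row n (suc (M + M))) M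

  row-shape-even n zero    = initialRow-shape n
  row-shape-even n (suc M) =
    subst (λ s → LeftHalfShape (row n s) (suc M)) (cong suc (sym (+-suc M M)))
      (row-step-shape n (suc (M + M)) (leftHalfShape-extend (row-middle n M) (row-shape-odd n M)))

  row-shape-odd n M = row-step-shape n (M + M) (row-shape-even n M)

  data EvenOrOdd : ℕ → Set where
    even : ∀ M → EvenOrOdd (M + M)
    odd  : ∀ M → EvenOrOdd (suc (M + M))

  evenOrOdd : ∀ s → EvenOrOdd s
  evenOrOdd zero          = even 0
  evenOrOdd (suc zero)    = odd 0
  evenOrOdd (suc (suc s)) with evenOrOdd s
  ... | even M = subst EvenOrOdd (cong suc (+-suc M M)) (even (suc M))
  ... | odd M  = subst EvenOrOdd (cong (2 +_) (+-suc M M)) (odd (suc M))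

  row-shape : ∀ n s → ∃ λ M → M ≤ s × s ≤ suc (M + M) × LeftHalfShape (row n s) M
  row-shape n s with evenOrOdd s
  ... | even M = M , m≤m+n M M , n≤1+n (M + M) , row-shape-even n M
  ... | odd M  = M , m≤n⇒m≤1+n (m≤m+n M M) , ≤-refl , row-shape-odd n M

open import Data.Nat.Base as ℕ using (ℕ; zero; suc; _+_; _∸_; z≤n; s≤s; _≤′_; ≤′-refl; ≤′-step)
import Data.Nat.Properties as ℕ
open import Data.Nat.Tactic.RingSolver using (solve-∀)
open import Data.Integer.Base using (ℤ; +_; -[1+_]; 0ℤ; _*_; _-_; _⊖_; _≤_; _<_; +≤+)
import Data.Integer.Properties as ℤ
open import Function using (flip)
open import Relation.Binary.Core using (Rel)
open import Relation.Binary.Definitions using (Reflexive; Transitive)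
open Firing using (IncreasingUpTo; ConvexAt; ConcaveAt; ConvexThenConcave)
open Rows using (row; row-1; Fℕ-row; row-shape)

module _ {a ℓ} {A : Set a} (_∼_ : Rel A ℓ) (∼-refl : Reflexive _∼_) (∼-trans : Transitive _∼_)
         (g : ℕ → A) where

  steps⇒related : ∀ {i j} → i ≤′ j → (∀ k → i ℕ.≤ k → k ℕ.< j → g k ∼ g (suc k)) →
                  g i ∼ g j
  steps⇒related ≤′-refl         _    = ∼-refl
  steps⇒related (≤′-step i≤′j) step =
    ∼-trans (steps⇒related i≤′j λ k i≤k k<j → step k i≤k (ℕ.m<n⇒m<1+n k<j))
            (step _ (ℕ.≤′⇒≤ i≤′j) ℕ.≤-refl)

[+m]-[+n]≤[+o]-[+p] : ∀ m n o p → m + p ℕ.≤ o + n → + m - + n ≤ + o - + p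
[+m]-[+n]≤[+o]-[+p] m n o p m+p≤o+n = begin
  + m - + n          ≡⟨ ℤ.[+m]-[+n]≡m⊖n m n ⟩
  m ⊖ n              ≡⟨ ℤ.+-cancelˡ-⊖ p m n ⟨
  (p + m) ⊖ (p + n)  ≡⟨ cong ((p + m) ⊖_) (ℕ.+-comm p n) ⟩
  (p + m) ⊖ (n + p)  ≤⟨ ℤ.⊖-monoˡ-≤ (n + p) p+m≤n+o ⟩
  (n + o) ⊖ (n + p)  ≡⟨ ℤ.+-cancelˡ-⊖ n o p ⟩
  o ⊖ p              ≡⟨ ℤ.[+m]-[+n]≡m⊖n o p ⟨
  + o - + p          ∎
  where
  open ℤ.≤-Reasoning
  p+m≤n+o : p + m ℕ.≤ n + o
  p+m≤n+o = subst₂ ℕ._≤_ (ℕ.+-comm m p) (ℕ.+-comm o n) m+p≤o+n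

Δ : (ℕ → ℕ) → ℕ → ℤ
Δ f k = + f (2 + k) - + f (1 + k)

Δ-nonneg : ∀ f k → f (1 + k) ℕ.≤ f (2 + k) → 0ℤ ≤ Δ f k
Δ-nonneg f k f[1+k]≤f[2+k] = ℤ.i≤j⇒0≤j-i (+≤+ f[1+k]≤f[2+k])

Δ-increasing : ∀ f k → ConvexAt f (suc k) → Δ f k ≤ Δ f (suc k)
Δ-increasing f k = [+m]-[+n]≤[+o]-[+p] (f (2 + k)) (f (1 + k)) (f (3 + k)) (f (2 + k))

Δ-decreasing : ∀ f k → ConcaveAt f (suc k) → Δ f (suc k) ≤ Δ f k
Δ-decreasing f k = [+m]-[+n]≤[+o]-[+p] (f (3 + k)) (f (2 + k)) (f (2 + k)) (f (1 + k))

UnimodalUpTo : (ℤ → ℤ) → ℤ → ℤ → Set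
UnimodalUpTo E L m = (∀ y₁ y₂ → y₁ ≤ y₂ → y₂ ≤ m → y₂ ≤ L → E y₁ ≤ E y₂)
                   × (∀ y₁ y₂ → m ≤ y₁ → y₁ ≤ y₂ → y₂ ≤ L → E y₂ ≤ E y₁)

differences-unimodal : ∀ (E : ℤ → ℤ) (f : ℕ → ℕ) {L p} → (∀ k → E -[1+ k ] ≡ 0ℤ) →
                       (∀ {k} → k ℕ.≤ L → E (+ k) ≡ Δ f k) →
                       IncreasingUpTo f (suc L) → ConvexThenConcave f L p →
                       UnimodalUpTo E (+ L) (+ p)
differences-unimodal E f {L} {p} E-neg E≡Δ inc (cvx , ccv) = up , down
  where
  nonneg : ∀ {k} → k ℕ.≤ L → 0ℤ ≤ E (+ k)
  nonneg {k} k≤L = subst (0ℤ ≤_) (sym (E≡Δ k≤L)) (Δ-nonneg f k (inc (suc k) (s≤s k≤L)))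

  step-up : ∀ k → k ℕ.< p → k ℕ.< L → E (+ k) ≤ E (+ suc k)
  step-up k k<p k<L = subst₂ _≤_ (sym (E≡Δ (ℕ.<⇒≤ k<L))) (sym (E≡Δ k<L))
                                (Δ-increasing f k (cvx (suc k) k<p k<L))

  step-down : ∀ k → p ℕ.≤ k → k ℕ.< L → E (+ suc k) ≤ E (+ k)
  step-down k p≤k k<L = subst₂ _≤_ (sym (E≡Δ k<L)) (sym (E≡Δ (ℕ.<⇒≤ k<L)))
                                  (Δ-decreasing f k (ccv (suc k) (s≤s p≤k) k<L))

  up : ∀ y₁ y₂ → y₁ ≤ y₂ → y₂ ≤ + p → y₂ ≤ + L → E y₁ ≤ E y₂
  up -[1+ j ] -[1+ k ] _ _ _ = ℤ.≤-reflexive (trans (E-neg j) (sym (E-neg k)))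
  up -[1+ j ] (+ k)    _ _ (+≤+ k≤L) = subst (_≤ E (+ k)) (sym (E-neg j)) (nonneg k≤L)
  up (+ j)    (+ k)    (+≤+ j≤k) (+≤+ k≤p) (+≤+ k≤L) =
    steps⇒related _≤_ ℤ.≤-refl ℤ.≤-trans (λ k → E (+ k)) (ℕ.≤⇒≤′ j≤k)
      λ i _ i<k → step-up i (ℕ.<-≤-trans i<k k≤p) (ℕ.<-≤-trans i<k k≤L)

  down : ∀ y₁ y₂ → + p ≤ y₁ → y₁ ≤ y₂ → y₂ ≤ + L → E y₂ ≤ E y₁
  down (+ j) (+ k) (+≤+ p≤j) (+≤+ j≤k) (+≤+ k≤L) =
    steps⇒related (flip _≤_) ℤ.≤-refl (flip ℤ.≤-trans) (λ k → E (+ k)) (ℕ.≤⇒≤′ j≤k)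
      λ i j≤i i<k → step-down i (ℕ.≤-trans p≤j j≤i) (ℕ.<-≤-trans i<k k≤L)

F-neg : ∀ n x k → F n x -[1+ k ] ≡ 0
F-neg n (+ x)    k = refl
F-neg n -[1+ x ] k = refl

rowEntry-neg : ∀ n i k → rowEntry n i -[1+ k ] ≡ 0ℤ
rowEntry-neg n i k =
  cong₂ (λ a b → + a - + b) (F-neg n (+ i - -[1+ k ] - + 1) k) (F-neg n (+ i - -[1+ k ]) (suc (k + 0)))

F′-row : ∀ n x y → F′ n (+ suc x) (+ y) ≡ Δ (row n (x + y)) y
F′-row n x zero    = cong₂ (λ a b → + a - + b) (Fℕ-row n x 0) (sym (row-1 n (x + 0)))
F′-row n x (suc y) =
  cong₂ (λ a b → + a - + b) (Fℕ-row n x (suc y))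
        (trans (Fℕ-row n (suc x) y) (cong (λ s → row n s (2 + y)) (sym (ℕ.+-suc x y))))

rowEntry-row : ∀ n s {k} → k ℕ.≤ s → rowEntry n (suc s) (+ k) ≡ Δ (row n s) k
rowEntry-row n s {k} k≤s = begin
  F′ n (+ suc s - + k) (+ k)   ≡⟨ cong (λ x → F′ n x (+ k)) suc-s-k ⟩
  F′ n (+ suc (s ∸ k)) (+ k)   ≡⟨ F′-row n (s ∸ k) k ⟩
  Δ (row n (s ∸ k + k)) k      ≡⟨ cong (λ t → Δ (row n t) k) (ℕ.m∸n+n≡m k≤s) ⟩
  Δ (row n s) k                ∎
  where
  open ≡-Reasoning
  suc-s-k : + suc s - + k ≡ + suc (s ∸ k)
  suc-s-k = trans (ℤ.[+m]-[+n]≡m⊖n (suc s) k)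
                  (trans (ℤ.⊖-≥ (ℕ.m≤n⇒m≤1+n k≤s)) (cong +_ (ℕ.+-∸-assoc 1 k≤s)))

rowEntry-unimodal : ∀ n i → ∃₂ λ M m → i ℕ.≤ 2 + (M + M) × UnimodalUpTo (rowEntry n i) (+ M) m
-- Row 0 of the difference table consists of the differences of the zero row -1 of F.
rowEntry-unimodal n zero = 0 , + 0 , z≤n ,
  differences-unimodal (rowEntry n 0) (λ _ → 0) (rowEntry-neg n 0) (λ { z≤n → refl })
                       (λ _ _ → z≤n) ((λ _ _ _ → z≤n) , (λ _ _ _ → z≤n))
rowEntry-unimodal n (suc s) with row-shape n s
... | M , M≤s , s≤1+2M , inc , p , shape = M , + p , s≤s s≤1+2M ,
  differences-unimodal (rowEntry n (suc s)) (row n s) (rowEntry-neg n (suc s))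
                       (λ k≤M → rowEntry-row n s (ℕ.≤-trans k≤M M≤s)) inc shape

half-bound : ∀ M {y} → + 2 * y < + (2 + (M + M)) → y ≤ + M
half-bound M {y} 2y<2+2M =
  ℤ.i<j⇒i≤pred[j] (ℤ.*-cancelˡ-<-nonNeg {j = + suc M} (+ 2)
                     (subst (+ 2 * y <_) (cong +_ (double M)) 2y<2+2M))
  where
  double : ∀ M → 2 + (M + M) ≡ 2 ℕ.* suc M
  double = solve-∀

theorem9p8 : (n i : ℕ) →
    ∃ λ (m : ℤ) →
      (∀ (y₁ y₂ : ℤ) → y₁ ≤ y₂ → y₂ ≤ m → + 2 * y₂ < + i →
        rowEntry n i y₁ ≤ rowEntry n i y₂)
      × (∀ (y₁ y₂ : ℤ) → m ≤ y₁ → y₁ ≤ y₂ → + 2 * y₂ < + i →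
        rowEntry n i y₂ ≤ rowEntry n i y₁)
theorem9p8 n i with M , m , i≤2+2M , up , down ← rowEntry-unimodal n i =
  m , (λ y₁ y₂ y₁≤y₂ y₂≤m 2y₂<i → up y₁ y₂ y₁≤y₂ y₂≤m (bound 2y₂<i))
    , (λ y₁ y₂ m≤y₁ y₁≤y₂ 2y₂<i → down y₁ y₂ m≤y₁ y₁≤y₂ (bound 2y₂<i))
  where
  bound : ∀ {y} → + 2 * y < + i → y ≤ + M
  bound 2y<i = half-bound M (ℤ.<-≤-trans 2y<i (+≤+ i≤2+2M))
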